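{- If $\mathcal D$ is a progressing $\mathsf B^-$-coderivation containing no instances of $\mathsf s_0$, $\mathsf s_1$ or $\mathsf{id}$, then $[\![\mathcal D]\!]$ is a relation, i.e. $[\![\mathcal D]\!](\vec x;\vec y)\leq 1$ for all $\vec x,\vec y$.
   Context: Types: $N$, $\Box N$; sequents $\Gamma\Rightarrow A$ with all $\Box N$ before all $N$. Rules of $\mathsf B^-$: $\mathsf{id}$: $N\Rightarrow N$; $\mathsf{cut}_N$: from $\Gamma\Rightarrow N$, $\Gamma,N\Rightarrow B$ infer $\Gamma\Rightarrow B$; $\mathsf{cut}_\Box$: from $\Gamma\Rightarrow\Box N$, $\Box N,\Gamma\Rightarrow B$ infer $\Gamma\Rightarrow B$; $\mathsf w_N,\mathsf w_\Box$ (weakening); exchange; $\Box_l$: from $\Gamma,N\Rightarrow A$ infer $\Box N,\Gamma\Rightarrow A$; $\Box_r$: from $\Box\Gamma\Rightarrow N$ infer $\Box\Gamma\Rightarrow\Box N$; $0,1$: $\Rightarrow N$; $\mathsf s_0,\mathsf s_1$: from $\Gamma\Rightarrow A$ infer $\Gamma\Rightarrow A$; $\mathsf{cond}_N$: from $\Gamma\Rightarrow N$, $\Gamma,N\Rightarrow N$, $\Gamma,N\Rightarrow N$ infer $\Gamma,N\Rightarrow N$; $\mathsf{cond}_\Box$: from $\Gamma\Rightarrow N$, $\Box N,\Gamma\Rightarrow N$, $\Box N,\Gamma\Rightarrow N$ infer $\Box N,\Gamma\Rightarrow N$; $|\mathsf{cond}|_N,|\mathsf{cond}|_\Box$: same with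 only the first two premises. A coderivation is a possibly infinite finitely branching tree built from these rules. Semantics (node with conclusion $\Box N^m,N^n\Rightarrow A$ denotes $f(x_1..x_m;y_1..y_n)$; $f_0,f_1,f_2$ for premises; $i\in\{0,1\}$, $2z+i\neq0$): $\mathsf{id}$: $f(;y)=y$; $\mathsf{cut}_N$: $f(\vec x;\vec y)=f_1(\vec x;\vec y,f_0(\vec x;\vec y))$; $\mathsf{cut}_\Box$: $f(\vec x;\vec y)=f_1(f_0(\vec x;\vec y),\vec x;\vec y)$; weakenings ignore the new argument; exchange permutes; $\Box_l$: $f(x,\vec x;\vec y)=f_0(\vec x;\vec y,x)$; $\Box_r$: $f(\vec x;)=f_0(\vec x;)$; $0,1$ constants; $\mathsf s_i$: $f=2f_0+i$; $\mathsf{cond}_N$: $f(\vec x;\vec y,0)=f_0(\vec x;\vec y)$, $f(\vec x;\vec y,2y+i)=f_{i+1}(\vec x;\vec y,y)$; $\mathsf{cond}_\Box$: $f(0,\vec x;\vec y)=f_0(\vec x;\vec y)$, $f(2x+i,\vec x;\vec y)=f_{i+1}(x,\vec x;\vec y)$; $|\mathsf{cond}|$ versions use $f_1$ for both $i$. $[\![\mathcal D]\!]$ is the partial function computed by this (possibly infinite) equational program (Kleene–Herbrand–Gödel sense). Immediate ancestry: side-context occurrences in premises are immediate ancestors of same-position occurrences in the conclusion; in $\Box_l$ the displayed $N$ is ancestor of the displayed $\Box N$; in conditionals the displayed formula of non-leftmost premises is ancestor of the principal one. A thread is a maximal ancestry path; progressing if eventually constantly $\Box N$ and infinitely often principal for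 $\mathsf{cond}_\Box$ or $|\mathsf{cond}|_\Box$. A coderivation is progressing if each infinite branch has a progressing thread. -}

module Defs where

open import Data.Nat using (ℕ; zero; suc; _+_; _*_; _<_; _≤_)
open import Data.Nat using (_≡ᵇ_)
open import Data.Bool using (if_then_else_)
open import Data.Fin using (Fin; toℕ)
open import Data.List using (List; []; _∷_; _++_; [_])
open import Data.Product using (_×_; ∃)
open import Data.Sum using (_⊎_)
open import Data.Empty using (⊥)
open import Data.Unit using (⊤)
open import Relation.Binary.PropositionalEquality using (_≡_; _≢_)

-- Types and sequents.  A sequent  □N^m , N^n ⇒ A  is recorded by (m, n, A).

data Ty : Set where
  nat box : Ty

record Seq : Set where
  constructor sq
  field
    m : ℕ      -- number of □N in the antecedent (they come first)
    n : ℕ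
    ty : Ty

-- Rule instances of B⁻ (with the parameters fixing the sequents).
-- exN m n B i / exB m n B i : exchange of positions i and i+1
-- among the N's / among the □N's (these generate all exchanges).

data Rule : Set where
  idR           : Rule
  cutN cutB     : ℕ → ℕ → Ty → Rule
  wkN wkB       : ℕ → ℕ → Ty → Rule
  exN exB       : ℕ → ℕ → Ty → ℕ → Rule
  boxL          : ℕ → ℕ → Ty → Rule
  boxR          : ℕ → Rule
  zeroR oneR    : Rule
  s0 s1         : ℕ → ℕ → Ty → Rule
  condN condB   : ℕ → ℕ → Rule
  condN' condB' : ℕ → ℕ → Rule      -- |cond|_N and |cond|_□

arity : Rule → ℕ
arity idR = 0
arity (cutN _ _ _) = 2
arity (cutB _ _ _) = 2
arity (wkN _ _ _) = 1
arity (wkB _ _ _) = 1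
arity (exN _ _ _ _) = 1
arity (exB _ _ _ _) = 1
arity (boxL _ _ _) = 1
arity (boxR _) = 1
arity zeroR = 0
arity oneR = 0
arity (s0 _ _ _) = 1
arity (s1 _ _ _) = 1
arity (condN _ _) = 3
arity (condB _ _) = 3
arity (condN' _ _) = 2
arity (condB' _ _) = 2

concl : Rule → Seq
concl idR = sq 0 1 nat
concl (cutN m n B) = sq m n B
concl (cutB m n B) = sq m n B
concl (wkN m n B) = sq m (suc n) B
concl (wkB m n B) = sq (suc m) n B
concl (exN m n B i) = sq m n B
concl (exB m n B i) = sq m n B
concl (boxL m n A) = sq (suc m) n A
concl (boxR m) = sq m 0 box
concl zeroR = sq 0 0 nat
concl oneR = sq 0 0 nat
concl (s0 m n A) = sq m n A
concl (s1 m n A) = sq m n A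
concl (condN m n) = sq m (suc n) nat
concl (condB m n) = sq (suc m) n nat
concl (condN' m n) = sq m (suc n) nat
concl (condB' m n) = sq (suc m) n nat

premSeq : (r : Rule) → Fin (arity r) → Seq
premSeq (cutN m n B) k with toℕ k
... | zero = sq m n nat
... | suc _ = sq m (suc n) B
premSeq (cutB m n B) k with toℕ k
... | zero = sq m n box
... | suc _ = sq (suc m) n B
premSeq (wkN m n B) _ = sq m n B
premSeq (wkB m n B) _ = sq m n B
premSeq (exN m n B i) _ = sq m n B
premSeq (exB m n B i) _ = sq m n B
premSeq (boxL m n A) _ = sq m (suc n) A
premSeq (boxR m) _ = sq m 0 nat
premSeq (s0 m n A) _ = sq m n A
premSeq (s1 m n A) _ = sq m n A
premSeq (condN m n) k with toℕ k
... | zero = sq m n nat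
... | suc _ = sq m (suc n) nat
premSeq (condB m n) k with toℕ k
... | zero = sq m n nat
... | suc _ = sq (suc m) n nat
premSeq (condN' m n) k with toℕ k
... | zero = sq m n nat
... | suc _ = sq m (suc n) nat
premSeq (condB' m n) k with toℕ k
... | zero = sq m n nat
... | suc _ = sq (suc m) n nat

RuleOK : Rule → Set
RuleOK (exN m n B i) = suc i < n
RuleOK (exB m n B i) = suc i < m
RuleOK _ = ⊤

-- Coderivations: possibly infinite, finitely branching trees, given by
-- a labelling of addresses.  Address  k ∷ a  is the k-th premise of  a.

Addr : Set
Addr = List ℕ

record Coderivation : Set where
  field
    rule   : Addr → Rule
    ruleOK : ∀ a → RuleOK (rule a)
    premOK : ∀ a (k : Fin (arity (rule a))) →
             concl (rule (toℕ k ∷ a)) ≡ premSeq (rule a) k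
open Coderivation public

data Reachable (D : Coderivation) : Addr → Set where
  root  : Reachable D []
  child : ∀ {a} k → Reachable D a → k < arity (rule D a) → Reachable D (k ∷ a)

nodeOf : (ℕ → ℕ) → ℕ → Addr
nodeOf dir zero = []
nodeOf dir (suc d) = dir d ∷ nodeOf dir d

record Branch (D : Coderivation) : Set where
  field
    dir   : ℕ → ℕ
    dirOK : ∀ d → dir d < arity (rule D (nodeOf dir d))
open Branch public

node : ∀ {D} → Branch D → ℕ → Addr
node β = nodeOf (dir β)

data Pos : Set where
  bx : ℕ → Pos
  nt : ℕ → Pos

ValidPos : Seq → Pos → Set
ValidPos (sq m n A) (bx i) = i < m
ValidPos (sq m n A) (nt j) = j < n

IsBox : Pos → Set
IsBox (bx _) = ⊤
IsBox (nt _) = ⊥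

swapIdx : ℕ → ℕ → ℕ
swapIdx i j = if j ≡ᵇ i then suc i else (if j ≡ᵇ suc i then i else j)

Same : ℕ → ℕ → Pos → Pos → Set
Same m n (bx i) (bx j) = i ≡ j × i < m
Same m n (nt i) (nt j) = i ≡ j × i < n
Same m n _ _ = ⊥

-- premise has one extra leading □N (not an ancestor)
PShift : ℕ → ℕ → Pos → Pos → Set
PShift m n (bx (suc i)) (bx j) = i ≡ j × i < m
PShift m n (nt i) (nt j) = i ≡ j × i < n
PShift m n _ _ = ⊥

-- conclusion has one extra leading □N
CShift : ℕ → ℕ → Pos → Pos → Set
CShift m n (bx i) (bx (suc j)) = i ≡ j × i < m
CShift m n (nt i) (nt j) = i ≡ j × i < n
CShift m n _ _ = ⊥

SwapN : ℕ → ℕ → ℕ → Pos → Pos → Set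
SwapN m n k (bx i) (bx j) = i ≡ j × i < m
SwapN m n k (nt i) (nt j) = swapIdx k i ≡ j × i < n
SwapN m n k _ _ = ⊥

SwapB : ℕ → ℕ → ℕ → Pos → Pos → Set
SwapB m n k (bx i) (bx j) = swapIdx k i ≡ j × i < m
SwapB m n k (nt i) (nt j) = i ≡ j × i < n
SwapB m n k _ _ = ⊥

-- Anc r k p q : occurrence p in premise k of r is an immediate
-- ancestor of occurrence q in the conclusion of r.
Anc : Rule → ℕ → Pos → Pos → Set
Anc (cutN m n B) 0 p q = Same m n p q
Anc (cutN m n B) 1 p q = Same m n p q
Anc (cutB m n B) 0 p q = Same m n p q
Anc (cutB m n B) 1 p q = PShift m n p q
Anc (wkN m n B) 0 p q = Same m n p q
Anc (wkB m n B) 0 p q = CShift m n p q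
Anc (exN m n B i) 0 p q = SwapN m n i p q
Anc (exB m n B i) 0 p q = SwapB m n i p q
Anc (boxL m n A) 0 p q = CShift m n p q ⊎ (p ≡ nt n × q ≡ bx 0)
Anc (boxR m) 0 p q = Same m 0 p q
Anc (s0 m n A) 0 p q = Same m n p q
Anc (s1 m n A) 0 p q = Same m n p q
Anc (condN m n) 0 p q = Same m n p q
Anc (condN m n) 1 p q = Same m (suc n) p q
Anc (condN m n) 2 p q = Same m (suc n) p q
Anc (condB m n) 0 p q = CShift m n p q
Anc (condB m n) 1 p q = Same (suc m) n p q
Anc (condB m n) 2 p q = Same (suc m) n p q
Anc (condN' m n) 0 p q = Same m n p q
Anc (condN' m n) 1 p q = Same m (suc n) p q
Anc (condB' m n) 0 p q = CShift m n p q
Anc (condB' m n) 1 p q = Same (suc m) n p q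
Anc _ _ _ _ = ⊥

PrincipalCondB : Rule → Pos → Set
PrincipalCondB (condB m n) (bx zero) = ⊤
PrincipalCondB (condB' m n) (bx zero) = ⊤
PrincipalCondB _ _ = ⊥

-- A progressing thread along a branch (its tail from depth `start`).
record ProgThread (D : Coderivation) (β : Branch D) : Set where
  field
    start  : ℕ
    pos    : ℕ → Pos
    valid  : ∀ d → start ≤ d → ValidPos (concl (rule D (node β d))) (pos d)
    anc    : ∀ d → start ≤ d →
             Anc (rule D (node β d)) (dir β d) (pos (suc d)) (pos d)
    eventuallyBox : ∃ λ d₀ → ∀ d → d₀ ≤ d → IsBox (pos d)
    infPrincipal  : ∀ d → ∃ λ d' → d ≤ d' ×
                    PrincipalCondB (rule D (node β d')) (pos d')

Progressing : Coderivation → Set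
Progressing D = (β : Branch D) → ProgThread D β

-- Semantics: the (Kleene–Herbrand–Gödel) partial function computed by the
-- equational program.  Eval D a xs ys v  :  f_a(xs ; ys) = v  is derivable.

swapL : ℕ → List ℕ → List ℕ
swapL zero (x ∷ y ∷ zs) = y ∷ x ∷ zs
swapL zero zs = zs
swapL (suc i) [] = []
swapL (suc i) (z ∷ zs) = z ∷ swapL i zs

data Eval (D : Coderivation) : Addr → List ℕ → List ℕ → ℕ → Set where
  e-id    : ∀ {a y} → rule D a ≡ idR → Eval D a [] (y ∷ []) y
  e-cutN  : ∀ {a m n B xs ys u v} → rule D a ≡ cutN m n B →
            Eval D (0 ∷ a) xs ys u → Eval D (1 ∷ a) xs (ys ++ [ u ]) v →
            Eval D a xs ys v
  e-cutB  : ∀ {a m n B xs ys u v} → rule D a ≡ cutB m n B →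
            Eval D (0 ∷ a) xs ys u → Eval D (1 ∷ a) (u ∷ xs) ys v →
            Eval D a xs ys v
  e-wkN   : ∀ {a m n B xs ys y v} → rule D a ≡ wkN m n B →
            Eval D (0 ∷ a) xs ys v → Eval D a xs (ys ++ [ y ]) v
  e-wkB   : ∀ {a m n B xs ys x v} → rule D a ≡ wkB m n B →
            Eval D (0 ∷ a) xs ys v → Eval D a (x ∷ xs) ys v
  e-exN   : ∀ {a m n B i xs ys v} → rule D a ≡ exN m n B i →
            Eval D (0 ∷ a) xs (swapL i ys) v → Eval D a xs ys v
  e-exB   : ∀ {a m n B i xs ys v} → rule D a ≡ exB m n B i →
            Eval D (0 ∷ a) (swapL i xs) ys v → Eval D a xs ys v
  e-boxL  : ∀ {a m n A x xs ys v} → rule D a ≡ boxL m n A →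
            Eval D (0 ∷ a) xs (ys ++ [ x ]) v → Eval D a (x ∷ xs) ys v
  e-boxR  : ∀ {a m xs v} → rule D a ≡ boxR m →
            Eval D (0 ∷ a) xs [] v → Eval D a xs [] v
  e-zero  : ∀ {a} → rule D a ≡ zeroR → Eval D a [] [] 0
  e-one   : ∀ {a} → rule D a ≡ oneR → Eval D a [] [] 1
  e-s0    : ∀ {a m n A xs ys v} → rule D a ≡ s0 m n A →
            Eval D (0 ∷ a) xs ys v → Eval D a xs ys (2 * v)
  e-s1    : ∀ {a m n A xs ys v} → rule D a ≡ s1 m n A →
            Eval D (0 ∷ a) xs ys v → Eval D a xs ys (2 * v + 1)
  e-condN₀ : ∀ {a m n xs ys v} → rule D a ≡ condN m n →
             Eval D (0 ∷ a) xs ys v → Eval D a xs (ys ++ [ 0 ]) v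
  e-condN₁ : ∀ {a m n xs ys y v} → rule D a ≡ condN m n → 2 * y ≢ 0 →
             Eval D (1 ∷ a) xs (ys ++ [ y ]) v → Eval D a xs (ys ++ [ 2 * y ]) v
  e-condN₂ : ∀ {a m n xs ys y v} → rule D a ≡ condN m n →
             Eval D (2 ∷ a) xs (ys ++ [ y ]) v → Eval D a xs (ys ++ [ 2 * y + 1 ]) v
  e-condB₀ : ∀ {a m n xs ys v} → rule D a ≡ condB m n →
             Eval D (0 ∷ a) xs ys v → Eval D a (0 ∷ xs) ys v
  e-condB₁ : ∀ {a m n xs ys x v} → rule D a ≡ condB m n → 2 * x ≢ 0 →
             Eval D (1 ∷ a) (x ∷ xs) ys v → Eval D a (2 * x ∷ xs) ys v
  e-condB₂ : ∀ {a m n xs ys x v} → rule D a ≡ condB m n →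
             Eval D (2 ∷ a) (x ∷ xs) ys v → Eval D a (2 * x + 1 ∷ xs) ys v
  e-condN'₀ : ∀ {a m n xs ys v} → rule D a ≡ condN' m n →
              Eval D (0 ∷ a) xs ys v → Eval D a xs (ys ++ [ 0 ]) v
  e-condN'₁ : ∀ {a m n xs ys y i v} → rule D a ≡ condN' m n → i < 2 →
              2 * y + i ≢ 0 →
              Eval D (1 ∷ a) xs (ys ++ [ y ]) v → Eval D a xs (ys ++ [ 2 * y + i ]) v
  e-condB'₀ : ∀ {a m n xs ys v} → rule D a ≡ condB' m n →
              Eval D (0 ∷ a) xs ys v → Eval D a (0 ∷ xs) ys v
  e-condB'₁ : ∀ {a m n xs ys x i v} → rule D a ≡ condB' m n → i < 2 →
              2 * x + i ≢ 0 →
              Eval D (1 ∷ a) (x ∷ xs) ys v → Eval D a (2 * x + i ∷ xs) ys v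

NoSId : Rule → Set
NoSId idR = ⊥
NoSId (s0 _ _ _) = ⊥
NoSId (s1 _ _ _) = ⊥
NoSId _ = ⊤

module Submission where

-- An evaluation derivation  Eval D a xs ys v  is a finite tree. At every rule
-- other than id, 0, 1, s₀ and s₁ the value v is the value of one premise, so by
-- induction on that tree v is produced by an axiom 0 or 1.

open import Defs
open import Data.Nat using (ℕ; _≤_; _<_; z≤n; s≤s; z<s; s<s)
open import Data.List using (List; []; length; _∷_)
open import Data.Empty using (⊥-elim)
open import Relation.Binary.PropositionalEquality using (_≡_; subst; sym)

premise-reachable : ∀ {D a r} k → rule D a ≡ r → k < arity r →
                    Reachable D a → Reachable D (k ∷ a)
premise-reachable k eq k<ar ra = child k ra (subst (λ r → k < arity r) (sym eq) k<ar)

module _ (D : Coderivation) (noSId : ∀ a → Reachable D a → NoSId (rule D a)) where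

  excluded : ∀ {a r} {A : Set} → rule D a ≡ r → (NoSId r → A) → Reachable D a → A
  excluded {a} eq absurd ra = absurd (subst NoSId eq (noSId a ra))

  eval≤1 : ∀ {a xs ys v} → Reachable D a → Eval D a xs ys v → v ≤ 1
  eval≤1 ra (e-zero _) = z≤n
  eval≤1 ra (e-one _)  = s≤s z≤n
  eval≤1 ra (e-id eq)   = excluded eq (λ ()) ra
  eval≤1 ra (e-s0 eq _) = excluded eq (λ ()) ra
  eval≤1 ra (e-s1 eq _) = excluded eq (λ ()) ra
  eval≤1 ra (e-cutN eq _ e)      = eval≤1 (premise-reachable 1 eq (s<s z<s) ra) e
  eval≤1 ra (e-cutB eq _ e)      = eval≤1 (premise-reachable 1 eq (s<s z<s) ra) e
  eval≤1 ra (e-wkN eq e)         = eval≤1 (premise-reachable 0 eq z<s ra) e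
  eval≤1 ra (e-wkB eq e)         = eval≤1 (premise-reachable 0 eq z<s ra) e
  eval≤1 ra (e-exN eq e)         = eval≤1 (premise-reachable 0 eq z<s ra) e
  eval≤1 ra (e-exB eq e)         = eval≤1 (premise-reachable 0 eq z<s ra) e
  eval≤1 ra (e-boxL eq e)        = eval≤1 (premise-reachable 0 eq z<s ra) e
  eval≤1 ra (e-boxR eq e)        = eval≤1 (premise-reachable 0 eq z<s ra) e
  eval≤1 ra (e-condN₀ eq e)      = eval≤1 (premise-reachable 0 eq z<s ra) e
  eval≤1 ra (e-condN₁ eq _ e)    = eval≤1 (premise-reachable 1 eq (s<s z<s) ra) e
  eval≤1 ra (e-condN₂ eq e)      = eval≤1 (premise-reachable 2 eq (s<s (s<s z<s)) ra) e
  eval≤1 ra (e-condB₀ eq e)      = eval≤1 (premise-reachable 0 eq z<s ra) e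
  eval≤1 ra (e-condB₁ eq _ e)    = eval≤1 (premise-reachable 1 eq (s<s z<s) ra) e
  eval≤1 ra (e-condB₂ eq e)      = eval≤1 (premise-reachable 2 eq (s<s (s<s z<s)) ra) e
  eval≤1 ra (e-condN'₀ eq e)     = eval≤1 (premise-reachable 0 eq z<s ra) e
  eval≤1 ra (e-condN'₁ eq _ _ e) = eval≤1 (premise-reachable 1 eq (s<s z<s) ra) e
  eval≤1 ra (e-condB'₀ eq e)     = eval≤1 (premise-reachable 0 eq z<s ra) e
  eval≤1 ra (e-condB'₁ eq _ _ e) = eval≤1 (premise-reachable 1 eq (s<s z<s) ra) e

mainTheorem10 : (D : Coderivation) → Progressing D →
    (∀ a → Reachable D a → NoSId (rule D a)) →
    ∀ (xs ys : List ℕ) (v : ℕ) →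
    length xs ≡ Seq.m (concl (rule D [])) →
    length ys ≡ Seq.n (concl (rule D [])) →
    Eval D [] xs ys v → v ≤ 1
mainTheorem10 D _ noSId _ _ _ _ _ = eval≤1 D noSId root
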